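{- For integers $n>3$ and $1\le k<n$, the $k$-derangement graph $\Gamma_{k,n}$ is connected.
   Context: $S_n$ is the symmetric group on $[n]=\{1,\dots,n\}$. For $\sigma\in S_n$, $\sigma_{(k)}$ denotes the induced permutation of the set of $k$-element subsets of $[n]$, $\sigma_{(k)}(\{a_1,\dots,a_k\})=\{\sigma(a_1),\dots,\sigma(a_k)\}$; $\sigma$ is a $k$-derangement if $\sigma_{(k)}$ fixes no $k$-element subset. Let $\mathcal{D}_{k,n}$ be the set of $k$-derangements in $S_n$ (it is closed under inverses). The $k$-derangement graph $\Gamma_{k,n}$ is the Cayley graph $\Gamma(S_n,\mathcal{D}_{k,n})$: its vertices are the elements of $S_n$, and $u,v$ are adjacent iff $su=v$ for some $s\in\mathcal{D}_{k,n}$. -}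

module Defs where

open import Data.Nat using (ℕ)
open import Data.Fin using (Fin)
open import Data.Fin.Subset using (Subset; ∣_∣)
open import Data.Fin.Permutation using (Permutation′; _⟨$⟩ʳ_; _⟨$⟩ˡ_; _∘ₚ_; _≈_)
open import Data.Vec using (tabulate; lookup)
open import Data.Product using (Σ; ∃; _×_)
open import Relation.Binary.PropositionalEquality using (_≡_; _≢_)

-- Note: (π ∘ₚ ρ) applies π first, then ρ; so the group product s·u
-- (apply u, then s) is  u ∘ₚ s.

image : {n : ℕ} → Permutation′ n → Subset n → Subset n
image σ S = tabulate (λ y → lookup S (σ ⟨$⟩ˡ y))

IsKDerangement : (k n : ℕ) → Permutation′ n → Set
IsKDerangement k n σ = (S : Subset n) → ∣ S ∣ ≡ k → image σ S ≢ S

Adjacent : (k n : ℕ) → Permutation′ n → Permutation′ n → Set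
Adjacent k n u v = ∃ (λ s → IsKDerangement k n s × (u ∘ₚ s) ≈ v)

data Walk (k n : ℕ) : Permutation′ n → Permutation′ n → Set where
  here  : ∀ {u v} → u ≈ v → Walk k n u v
  step  : ∀ {u w v} → Adjacent k n u w → Walk k n w v → Walk k n u v

Connected : (k n : ℕ) → Set
Connected k n = (u v : Permutation′ n) → Walk k n u v

module Submission where

-- σ fixes a k-subset S exactly when S is σ-invariant, so σ is a k-derangement
-- iff no k-subset is σ-invariant.  Inverting σ or conjugating it transports
-- invariant subsets and preserves their size, so the k-derangements are closed
-- under inverses and conjugation.  Walks from the identity in Γ_{k,n} are the
-- products of k-derangements; they form a subgroup closed under conjugation,
-- and Γ_{k,n} is connected once this subgroup is all of S_n.
--
-- The n-cycle r leaves only ∅ and [n] invariant, so it is a k-derangement.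
-- Fixing 0 and cycling the other n-1 points gives β with β(x) = t₀₁(r(x));
-- swapping 0,1 and cycling the other n-2 points gives γ with γ(x) = t₀₂(r(x)).
-- For n ≥ 4, β is a k-derangement when 2 ≤ k ≤ n-2 and γ is one when
-- k ∈ {1, n-1}.  Either way the subgroup contains a transposition t₀ᵦ, hence
-- (by conjugation) all transpositions, hence all of S_n.

open import Defs
open import Data.Nat using (ℕ; zero; suc; _<_; _≤_; s≤s)
open import Data.Nat.Properties using (+-0-commutativeMonoid; <⇒≢; 1+n≢n; suc-injective) renaming (_≟_ to _≟ℕ_)
open import Data.Bool using (Bool; true; false)
open import Data.Fin using (Fin; zero; suc; inject₁)
open import Data.Fin.Properties using (_≟_)
open import Data.Fin.Subset using (Subset; ∣_∣; ⊤; ⊥)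
open import Data.Fin.Subset.Properties using (∣⊤∣≡n; ∣⊥∣≡0)
open import Data.Fin.Permutation using (Permutation′; _⟨$⟩ʳ_; _⟨$⟩ˡ_; _∘ₚ_; _≈_; id; flip; inverseˡ; inverseʳ; lift₀; swap; transpose)
import Data.Fin.Permutation.Components as PC
import Data.List as List
open import Data.Fin.Permutation.Transposition.List using (TranspositionList; eval; decompose; eval-decompose)
open import Data.Vec using ([]; _∷_; lookup; tabulate; replicate)
open import Data.Vec.Properties using (lookup∘tabulate; tabulate∘lookup; tabulate-cong; lookup-replicate)
open import Data.Product using (Σ; _×_; _,_)
open import Data.Sum using (_⊎_; inj₁; inj₂)
open import Function using (_∘_)
open import Relation.Nullary using (Dec; yes; no)
open import Relation.Nullary.Decidable using (dec-true; dec-false)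
open import Relation.Binary.PropositionalEquality
open import Algebra.Properties.CommutativeMonoid.Sum +-0-commutativeMonoid using (sum; sum-permute; sum-cong-≗)
open ≡-Reasoning

private
  variable
    k n : ℕ

Invariant : Permutation′ n → Subset n → Set
Invariant σ S = ∀ x → lookup S (σ ⟨$⟩ʳ x) ≡ lookup S x

fixed⇒invariant : (σ : Permutation′ n) (S : Subset n) → image σ S ≡ S → Invariant σ S
fixed⇒invariant σ S fixed x = begin
  lookup S (σ ⟨$⟩ʳ x)             ≡⟨ cong (λ T → lookup T (σ ⟨$⟩ʳ x)) fixed ⟨
  lookup (image σ S) (σ ⟨$⟩ʳ x)   ≡⟨ lookup∘tabulate _ (σ ⟨$⟩ʳ x) ⟩
  lookup S (σ ⟨$⟩ˡ (σ ⟨$⟩ʳ x))    ≡⟨ cong (lookup S) (inverseˡ σ) ⟩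
  lookup S x                      ∎

invariant⇒fixed : (σ : Permutation′ n) (S : Subset n) → Invariant σ S → image σ S ≡ S
invariant⇒fixed σ S inv = begin
  tabulate (λ y → lookup S (σ ⟨$⟩ˡ y))  ≡⟨ tabulate-cong moved ⟩
  tabulate (lookup S)                   ≡⟨ tabulate∘lookup S ⟩
  S                                     ∎
  where
  moved : ∀ y → lookup S (σ ⟨$⟩ˡ y) ≡ lookup S y
  moved y = trans (sym (inv (σ ⟨$⟩ˡ y))) (cong (lookup S) (inverseʳ σ))

invariant-derangement : (σ : Permutation′ n) →
                        (∀ S → Invariant σ S → ∣ S ∣ ≢ k) → IsKDerangement k n σ
invariant-derangement σ noInvariant S size fixed =
  noInvariant S (fixed⇒invariant σ S fixed) size

derangement-invariant : (σ : Permutation′ n) →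
                        IsKDerangement k n σ → ∀ S → Invariant σ S → ∣ S ∣ ≢ k
derangement-invariant σ der S inv size = der S size (invariant⇒fixed σ S inv)

-- The size of a subset is the sum of its 0/1 indicator, so sums over [n]
-- can be reindexed by a permutation.
indicator : Bool → ℕ
indicator true  = 1
indicator false = 0

size-as-sum : (S : Subset n) → ∣ S ∣ ≡ sum (indicator ∘ lookup S)
size-as-sum []          = refl
size-as-sum (true ∷ S)  = cong suc (size-as-sum S)
size-as-sum (false ∷ S) = size-as-sum S

image-size : (π : Permutation′ n) (S : Subset n) → ∣ image π S ∣ ≡ ∣ S ∣
image-size {n} π S = begin
  ∣ image π S ∣                          ≡⟨ size-as-sum (image π S) ⟩
  sum (indicator ∘ lookup (image π S))   ≡⟨ sum-cong-≗ {n} (λ y → cong indicator (lookup∘tabulate _ y)) ⟩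
  sum (λ y → indicator (lookup S (π ⟨$⟩ˡ y)))  ≡⟨ sum-permute (indicator ∘ lookup S) (flip π) ⟨
  sum (indicator ∘ lookup S)             ≡⟨ size-as-sum S ⟨
  ∣ S ∣                                  ∎

invariant-inverse : (σ : Permutation′ n) (S : Subset n) → Invariant (flip σ) S → Invariant σ S
invariant-inverse σ S inv x = begin
  lookup S (σ ⟨$⟩ʳ x)                  ≡⟨ inv (σ ⟨$⟩ʳ x) ⟨
  lookup S (σ ⟨$⟩ˡ (σ ⟨$⟩ʳ x))         ≡⟨ cong (lookup S) (inverseˡ σ) ⟩
  lookup S x                           ∎

inverse-derangement : (σ : Permutation′ n) → IsKDerangement k n σ → IsKDerangement k n (flip σ)
inverse-derangement σ der =
  invariant-derangement (flip σ) λ S inv → derangement-invariant σ der S (invariant-inverse σ S inv)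

-- The conjugate τ π τ⁻¹ (apply τ⁻¹, then π, then τ).
conj : Permutation′ n → Permutation′ n → Permutation′ n
conj τ π = flip τ ∘ₚ π ∘ₚ τ

invariant-conj : (τ π : Permutation′ n) (S : Subset n) →
                 Invariant (conj τ π) S → Invariant π (image (flip τ) S)
invariant-conj τ π S inv y = begin
  lookup (image (flip τ) S) (π ⟨$⟩ʳ y)          ≡⟨ lookup∘tabulate _ (π ⟨$⟩ʳ y) ⟩
  lookup S (τ ⟨$⟩ʳ (π ⟨$⟩ʳ y))                  ≡⟨ cong (λ z → lookup S (τ ⟨$⟩ʳ (π ⟨$⟩ʳ z))) (inverseˡ τ) ⟨
  lookup S (conj τ π ⟨$⟩ʳ (τ ⟨$⟩ʳ y))           ≡⟨ inv (τ ⟨$⟩ʳ y) ⟩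
  lookup S (τ ⟨$⟩ʳ y)                           ≡⟨ lookup∘tabulate _ y ⟨
  lookup (image (flip τ) S) y                   ∎

conj-derangement : (τ s : Permutation′ n) →
                   IsKDerangement k n s → IsKDerangement k n (conj τ s)
conj-derangement τ s der = invariant-derangement (conj τ s) λ S inv size →
  derangement-invariant s der (image (flip τ) S) (invariant-conj τ s S inv)
    (trans (image-size (flip τ) S) size)

walk-≈ˡ : {u′ u v : Permutation′ n} → u′ ≈ u → Walk k n u v → Walk k n u′ v
walk-≈ˡ u′≈u (here u≈v) = here (λ x → trans (u′≈u x) (u≈v x))
walk-≈ˡ u′≈u (step (s , der , us≈w) walk) =
  step (s , der , λ x → trans (cong (s ⟨$⟩ʳ_) (u′≈u x)) (us≈w x)) walk

walk-++ : {u w v : Permutation′ n} → Walk k n u w → Walk k n w v → Walk k n u v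
walk-++ (here u≈w)       walk′ = walk-≈ˡ u≈w walk′
walk-++ (step adj walk)  walk′ = step adj (walk-++ walk walk′)

-- Γ_{k,n} is a Cayley graph, hence invariant under translation t ∘ₚ _ ...
walk-translate : (t : Permutation′ n) {u v : Permutation′ n} →
                 Walk k n u v → Walk k n (t ∘ₚ u) (t ∘ₚ v)
walk-translate t (here u≈v)                  = here (u≈v ∘ (t ⟨$⟩ʳ_))
walk-translate t (step (s , der , us≈w) walk) =
  step (s , der , us≈w ∘ (t ⟨$⟩ʳ_)) (walk-translate t walk)

-- ... and, the connection set being closed under conjugation, under conjugation.
walk-conj : (τ : Permutation′ n) {u v : Permutation′ n} →
            Walk k n u v → Walk k n (conj τ u) (conj τ v)
walk-conj τ (here u≈v)                   = here (λ x → cong (τ ⟨$⟩ʳ_) (u≈v _))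
walk-conj τ (step {u} {w} (s , der , us≈w) walk) =
  step (conj τ s , conj-derangement τ s der , conjugated) (walk-conj τ walk)
  where
  conjugated : (conj τ u ∘ₚ conj τ s) ≈ conj τ w
  conjugated x = cong (τ ⟨$⟩ʳ_) (trans (cong (s ⟨$⟩ʳ_) (inverseˡ τ)) (us≈w _))

-- π is a product of k-derangements: it is reachable from the identity.
Generated : (k n : ℕ) → Permutation′ n → Set
Generated k n π = Walk k n id π

generated-≈ : {π ρ : Permutation′ n} → Generated k n π → π ≈ ρ → Generated k n ρ
generated-≈ gen π≈ρ = walk-++ gen (here π≈ρ)

generated-derangement : (s : Permutation′ n) → IsKDerangement k n s → Generated k n s
generated-derangement s der = step {w = s} (s , der , λ x → refl) (here (λ x → refl))

generated-∘ : {π ρ : Permutation′ n} → Generated k n π → Generated k n ρ → Generated k n (π ∘ₚ ρ)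
generated-∘ {π = π} genπ genρ = walk-++ genπ (walk-≈ˡ (λ x → refl) (walk-translate π genρ))

generated-conj : (τ : Permutation′ n) {π : Permutation′ n} → Generated k n π → Generated k n (conj τ π)
generated-conj τ gen = walk-≈ˡ (λ x → sym (inverseʳ τ)) (walk-conj τ gen)

quotient-generated : (σ ρ τ : Permutation′ n) → IsKDerangement k n σ → IsKDerangement k n ρ →
                     (∀ x → ρ ⟨$⟩ʳ x ≡ τ ⟨$⟩ʳ (σ ⟨$⟩ʳ x)) → Generated k n τ
quotient-generated σ ρ τ derσ derρ ρ≡τσ =
  generated-≈ (generated-∘ (generated-derangement (flip σ) (inverse-derangement σ derσ))
                           (generated-derangement ρ derρ))
              (λ x → trans (ρ≡τσ (σ ⟨$⟩ˡ x)) (cong (τ ⟨$⟩ʳ_) (inverseʳ σ)))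

connected-if-generating : (∀ π → Generated k n π) → Connected k n
connected-if-generating all u v =
  walk-++ (walk-≈ˡ (λ x → refl) (walk-translate u (all (flip u ∘ₚ v))))
          (here (λ x → cong (v ⟨$⟩ʳ_) (inverseˡ u)))

transpose-matchˡ : (i j : Fin n) → PC.transpose i j i ≡ j
transpose-matchˡ i j rewrite dec-true (i ≟ i) refl = refl

transpose-matchʳ : (i j : Fin n) → PC.transpose i j j ≡ i
transpose-matchʳ i j with i ≟ j
... | yes refl rewrite dec-true (i ≟ i) refl = refl
... | no i≢j rewrite dec-false (j ≟ i) (i≢j ∘ sym) | dec-true (j ≟ j) refl = refl

transpose-other : (i j x : Fin n) → x ≢ i → x ≢ j → PC.transpose i j x ≡ x
transpose-other i j x x≢i x≢j rewrite dec-false (x ≟ i) x≢i | dec-false (x ≟ j) x≢j = refl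

transpose-same : (i : Fin n) → transpose i i ≈ id
transpose-same i x = decide (x ≟ i)
  where
  decide : Dec (x ≡ i) → PC.transpose i i x ≡ x
  decide (yes refl) = transpose-matchˡ x x
  decide (no x≢i)   = transpose-other i i x x≢i x≢i

transpose-natural : (ρ : Permutation′ n) (a b y : Fin n) →
                    ρ ⟨$⟩ʳ PC.transpose a b y ≡ PC.transpose (ρ ⟨$⟩ʳ a) (ρ ⟨$⟩ʳ b) (ρ ⟨$⟩ʳ y)
transpose-natural ρ a b y = decide (y ≟ a) (y ≟ b)
  where
  injective : ∀ {z} → ρ ⟨$⟩ʳ y ≡ ρ ⟨$⟩ʳ z → y ≡ z
  injective e = trans (sym (inverseˡ ρ)) (trans (cong (ρ ⟨$⟩ˡ_) e) (inverseˡ ρ))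

  decide : Dec (y ≡ a) → Dec (y ≡ b) →
           ρ ⟨$⟩ʳ PC.transpose a b y ≡ PC.transpose (ρ ⟨$⟩ʳ a) (ρ ⟨$⟩ʳ b) (ρ ⟨$⟩ʳ y)
  decide (yes refl) _ =
    trans (cong (ρ ⟨$⟩ʳ_) (transpose-matchˡ y b)) (sym (transpose-matchˡ (ρ ⟨$⟩ʳ y) (ρ ⟨$⟩ʳ b)))
  decide (no _) (yes refl) =
    trans (cong (ρ ⟨$⟩ʳ_) (transpose-matchʳ a y)) (sym (transpose-matchʳ (ρ ⟨$⟩ʳ a) (ρ ⟨$⟩ʳ y)))
  decide (no y≢a) (no y≢b) =
    trans (cong (ρ ⟨$⟩ʳ_) (transpose-other a b y y≢a y≢b))
          (sym (transpose-other _ _ (ρ ⟨$⟩ʳ y) (y≢a ∘ injective) (y≢b ∘ injective)))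

conj-transpose : (ρ : Permutation′ n) (a b : Fin n) →
                 conj ρ (transpose a b) ≈ transpose (ρ ⟨$⟩ʳ a) (ρ ⟨$⟩ʳ b)
conj-transpose ρ a b x =
  trans (transpose-natural ρ a b (ρ ⟨$⟩ˡ x)) (cong (PC.transpose _ _) (inverseʳ ρ))

-- One generated transposition t_{0b} yields all of them: t_{ij} = ρ t_{0b} ρ⁻¹
-- for ρ = t_{0i} ∘ t_{b,j′} with j′ = t_{0i}(j).
all-transpositions-generated : {b : Fin (suc n)} → b ≢ zero → Generated k (suc n) (transpose zero b) →
                               ∀ i j → Generated k (suc n) (transpose i j)
all-transpositions-generated b≢0 gen i j with i ≟ j
... | yes refl = here (λ x → sym (transpose-same i x))
all-transpositions-generated {b = b} b≢0 gen i j | no i≢j =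
  generated-≈ (generated-conj ρ gen)
    (λ x → trans (conj-transpose ρ zero b x) (cong₂ (λ p q → PC.transpose p q x) ρ0≡i ρb≡j))
  where
  j′ = PC.transpose i zero j
  ρ = transpose b j′ ∘ₚ transpose zero i

  j′≢0 : j′ ≢ zero
  j′≢0 j′≡0 = i≢j (begin
    i                         ≡⟨ transpose-matchˡ zero i ⟨
    PC.transpose zero i zero  ≡⟨ cong (PC.transpose zero i) j′≡0 ⟨
    PC.transpose zero i j′    ≡⟨ PC.transpose-inverse zero i ⟩
    j                         ∎)

  ρ0≡i : ρ ⟨$⟩ʳ zero ≡ i
  ρ0≡i = trans (cong (PC.transpose zero i) (transpose-other b j′ zero (b≢0 ∘ sym) (j′≢0 ∘ sym)))
               (transpose-matchˡ zero i)

  ρb≡j : ρ ⟨$⟩ʳ b ≡ j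
  ρb≡j = trans (cong (PC.transpose zero i) (transpose-matchˡ b j′)) (PC.transpose-inverse zero i)

-- Every permutation is a product of transpositions.
all-generated : (∀ (i j : Fin n) → Generated k n (transpose i j)) → ∀ π → Generated k n π
all-generated {n = n} {k = k} transpositions π =
  generated-≈ (generated-eval (decompose π)) (eval-decompose π)
  where
  generated-eval : (xs : TranspositionList n) → Generated k n (eval xs)
  generated-eval List.[]             = here (λ x → refl)
  generated-eval ((i , j) List.∷ xs) = generated-∘ (transpositions i j) (generated-eval xs)

-- The n-cycle x ↦ x + 1 (mod n), built as lift₀ (cycle (n-1)) followed by t₀₁.
cycle : ∀ n → Permutation′ n
cycle zero                = id
cycle (suc zero)          = id
cycle (suc (suc n))       = lift₀ (cycle (suc n)) ∘ₚ transpose zero (suc zero)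

cycle-step : (i : Fin n) → cycle (suc n) ⟨$⟩ʳ inject₁ i ≡ suc i
cycle-step {suc n} zero    = refl
cycle-step {suc n} (suc i) = cong (PC.transpose zero (suc zero) ∘ suc) (cycle-step i)

neighbours-constant : {A : Set} (f : Fin (suc n) → A) →
                      (∀ (i : Fin n) → f (inject₁ i) ≡ f (suc i)) → ∀ x → f x ≡ f zero
neighbours-constant         f agree zero    = refl
neighbours-constant {suc n} f agree (suc i) =
  trans (sym (agree i)) (neighbours-constant (f ∘ inject₁) (agree ∘ inject₁) i)

constant-subset : (S : Subset n) (b : Bool) → (∀ x → lookup S x ≡ b) → S ≡ replicate n b
constant-subset S b constant = begin
  S                                   ≡⟨ tabulate∘lookup S ⟨
  tabulate (lookup S)                 ≡⟨ tabulate-cong (λ x → trans (constant x) (sym (lookup-replicate x b))) ⟩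
  tabulate (lookup (replicate _ b))   ≡⟨ tabulate∘lookup (replicate _ b) ⟩
  replicate _ b                       ∎

cycle-invariant : (S : Subset (suc n)) → Invariant (cycle (suc n)) S → S ≡ ⊥ ⊎ S ≡ ⊤
cycle-invariant S inv = cases (lookup S zero) (constant-subset S (lookup S zero) (neighbours-constant (lookup S) agree))
  where
  agree : ∀ i → lookup S (inject₁ i) ≡ lookup S (suc i)
  agree i = trans (sym (inv (inject₁ i))) (cong (lookup S) (cycle-step i))

  cases : ∀ b → S ≡ replicate _ b → S ≡ ⊥ ⊎ S ≡ ⊤
  cases false S≡⊥ = inj₁ S≡⊥
  cases true  S≡⊤ = inj₂ S≡⊤

cycle-derangement : k ≢ 0 → k ≢ suc n → IsKDerangement k (suc n) (cycle (suc n))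
cycle-derangement {k} {n} k≢0 k≢n = invariant-derangement (cycle (suc n)) noInvariant
  where
  trivial : {S : Subset (suc n)} → S ≡ ⊥ ⊎ S ≡ ⊤ → ∣ S ∣ ≢ k
  trivial (inj₁ refl) size = k≢0 (trans (sym size) (∣⊥∣≡0 (suc n)))
  trivial (inj₂ refl) size = k≢n (trans (sym size) (∣⊤∣≡n (suc n)))

  noInvariant : ∀ S → Invariant (cycle (suc n)) S → ∣ S ∣ ≢ k
  noInvariant S inv = trivial (cycle-invariant S inv)

-- Fixing the point 0: an invariant k-subset of lift₀ σ restricts to an invariant
-- k- or (k-1)-subset of σ.
lift₀-derangement : (σ : Permutation′ n) → IsKDerangement k n σ →
                    (∀ {j} → suc j ≡ k → IsKDerangement j n σ) →
                    IsKDerangement k (suc n) (lift₀ σ)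
lift₀-derangement {k = k} σ der der′ = invariant-derangement (lift₀ σ) noInvariant
  where
  noInvariant : ∀ S → Invariant (lift₀ σ) S → ∣ S ∣ ≢ k
  noInvariant (false ∷ T) inv      = derangement-invariant σ der T (inv ∘ suc)
  noInvariant (true ∷ T)  inv size = derangement-invariant σ (der′ size) T (inv ∘ suc) refl

-- Swapping 0 and 1: an invariant subset of swap σ contains both or neither of
-- them, and restricts to an invariant k- or (k-2)-subset of σ.
swap-derangement : (σ : Permutation′ n) → IsKDerangement k n σ →
                   (∀ {j} → suc (suc j) ≡ k → IsKDerangement j n σ) →
                   IsKDerangement k (suc (suc n)) (swap σ)
swap-derangement {k = k} σ der der′ = invariant-derangement (swap σ) noInvariant
  where
  noInvariant : ∀ S → Invariant (swap σ) S → ∣ S ∣ ≢ k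
  noInvariant (a ∷ a′ ∷ T) inv with inv zero
  noInvariant (false ∷ .false ∷ T) inv | refl = derangement-invariant σ der T (λ y → inv (suc (suc y)))
  noInvariant (true ∷ .true ∷ T)   inv | refl =
    λ size → derangement-invariant σ (der′ size) T (λ y → inv (suc (suc y))) refl

swap-cycle : ∀ m (x : Fin (suc (suc (suc m)))) →
             swap (cycle (suc m)) ⟨$⟩ʳ x ≡ PC.transpose zero (suc (suc zero)) (cycle (suc (suc (suc m))) ⟨$⟩ʳ x)
swap-cycle m zero          = refl
swap-cycle m (suc zero)    = refl
swap-cycle m (suc (suc i)) = shifted (cycle (suc m) ⟨$⟩ʳ i)
  where
  shifted : ∀ (y : Fin (suc m)) → suc (suc y) ≡
            PC.transpose zero (suc (suc zero)) (PC.transpose zero (suc zero) (suc (PC.transpose zero (suc zero) (suc y))))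
  shifted zero    = refl
  shifted (suc y) = refl

transposition-generated : ∀ m j → j < suc (suc (suc m)) →
                          Σ (Fin (suc (suc (suc (suc m))))) λ b →
                            b ≢ zero × Generated (suc j) (suc (suc (suc (suc m)))) (transpose zero b)
transposition-generated m j j<n = choose (j ≟ℕ 0) (j ≟ℕ suc (suc m))
  where
  N = suc (suc (suc (suc m)))
  Goal = Σ (Fin N) λ b → b ≢ zero × Generated (suc j) N (transpose zero b)

  r = cycle N
  r-derangement : IsKDerangement (suc j) N r
  r-derangement = cycle-derangement (λ ()) (<⇒≢ (s≤s j<n))

  γ = swap (cycle (suc (suc m)))
  viaγ : IsKDerangement (suc j) N γ → Goal
  viaγ γ-derangement =
    suc (suc zero) , (λ ()) , quotient-generated r γ _ r-derangement γ-derangement (swap-cycle (suc m))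

  β = lift₀ (cycle (suc (suc (suc m))))
  viaβ : IsKDerangement (suc j) N β → Goal
  viaβ β-derangement = suc zero , (λ ()) , quotient-generated β r _ β-derangement r-derangement (λ x → refl)

  choose : Dec (j ≡ 0) → Dec (j ≡ suc (suc m)) → Goal
  choose (yes refl) _          =
    viaγ (swap-derangement (cycle (suc (suc m))) (cycle-derangement (λ ()) (λ ())) (λ ()))
  choose (no _)     (yes refl) =
    viaγ (swap-derangement (cycle (suc (suc m))) (cycle-derangement (λ ()) 1+n≢n)
           (λ { refl → cycle-derangement (λ ()) (1+n≢n ∘ sym) }))
  choose (no j≢0)   (no j≢n-2) =
    viaβ (lift₀-derangement (cycle (suc (suc (suc m)))) (cycle-derangement (λ ()) (j≢n-2 ∘ suc-injective))
           (λ { refl → cycle-derangement j≢0 (<⇒≢ j<n) }))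

theorem1 : (n k : ℕ) → 3 < n → 1 ≤ k → k < n → Connected k n
theorem1 (suc (suc (suc (suc m)))) (suc j) (s≤s (s≤s (s≤s (s≤s _)))) (s≤s _) (s≤s j<n) =
  let (b , b≢0 , t₀ᵦ-generated) = transposition-generated m j j<n
  in connected-if-generating (all-generated (all-transpositions-generated b≢0 t₀ᵦ-generated))
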